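{- For all natural numbers $k,s,n$ with $2\leq k\leq s$, $s<2k$ and $s+k<n$, we have $1<D(k,s,n)$.
   Context: For a natural number $n$, $[n]=\{1,\dots,n\}$, and for a set $A$ and $s\in\mathbb{N}$, $\binom{A}{s}$ denotes the set of $s$-element subsets of $A$. A set $A$ is shattered by a family $\mathcal{F}$ of sets if $\{A\cap S: S\in\mathcal{F}\}=2^A$. The VC-dimension of $\mathcal{F}$ is the size of the largest finite set shattered by $\mathcal{F}$. A family $\mathcal{F}\subseteq 2^X$ has the $k$-covering property if every $k$-element subset of $X$ is contained in some member of $\mathcal{F}$. For natural numbers $k\leq s\leq n$, $D(k,s,n)$ denotes the smallest VC-dimension of a family $\mathcal{F}\subseteq\binom{[n]}{s}$ having the $k$-covering property (as subsets of $[n]$). -}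

module Defs where

open import Data.Nat using (ℕ; _≤_)
open import Data.Fin.Subset using (Subset; _⊆_; _∩_; ∣_∣)
open import Data.List using (List)
open import Data.List.Relation.Unary.All using (All)
open import Data.List.Relation.Unary.Any using (Any)
open import Data.Product using (Σ; _×_; ∃)
open import Relation.Binary.PropositionalEquality using (_≡_)

Family : ℕ → Set
Family n = List (Subset n)

Uniform : ∀ {n} → ℕ → Family n → Set
Uniform s F = All (λ S → ∣ S ∣ ≡ s) F

Covering : ∀ {n} → ℕ → Family n → Set
Covering {n} k F = (A : Subset n) → ∣ A ∣ ≡ k → Any (λ S → A ⊆ S) F

-- A is shattered by F: {A ∩ S : S ∈ F} = 2^A, i.e. every B ⊆ A equals A ∩ S for some S ∈ F
-- (the other inclusion, A ∩ S ⊆ A, is automatic).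
Shattered : ∀ {n} → Family n → Subset n → Set
Shattered F A = ∀ B → B ⊆ A → Any (λ S → A ∩ S ≡ B) F

IsVCdim : ∀ {n} → Family n → ℕ → Set
IsVCdim {n} F d =
  (Σ (Subset n) λ A → ∣ A ∣ ≡ d × Shattered F A) ×
  ((A : Subset n) → Shattered F A → ∣ A ∣ ≤ d)

IsD : ℕ → ℕ → ℕ → ℕ → Set
IsD k s n d =
  (Σ (Family n) λ F → Uniform s F × Covering k F × IsVCdim F d) ×
  ((F : Family n) (d′ : ℕ) → Uniform s F → Covering k F → IsVCdim F d′ → d ≤ d′)

{-# OPTIONS --safe #-}
-- Fix a member S₀ of the family. Two points x, y outside S₀ form a shattered pair as soon as
-- some member contains x but not y and another contains y but not x: S₀ misses both, and since
-- k ≥ 2 some member contains both. For x ∉ S₀, cover x together with k − 1 points of S₀ by a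
-- member S; since (k − 1) + (n − s) > s, S misses some y ∉ S₀. If no member contains y but not
-- x, then y lies in strictly fewer members than x, so descending along this number ends at a
-- suitable pair.
module Submission where

open import Defs
open import Data.Nat using (ℕ; zero; suc; _+_; _*_; _∸_; _≤_; _<_; z≤n; s≤s; _≤?_)
open import Data.Nat.Properties
open import Data.Nat.Induction using (<-wellFounded)
open import Data.Fin using (Fin)
open import Data.Fin.Properties using (¬∀⟶∃¬)
open import Data.Vec using ([]; _∷_; here; there)
open import Data.Fin.Subset
open import Data.Fin.Subset.Properties
open import Data.List using ([]; _∷_; filter; length)
open import Data.List.Relation.Unary.All as All using ()
open import Data.List.Relation.Unary.Any as Any using (Any; satisfied)
open import Data.List.Membership.Propositional using (find; lose) renaming (_∈_ to _∈ₗ_)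
open import Data.Product using (∃; ∃₂; _×_; _,_)
open import Data.Sum as Sum using (_⊎_; inj₁; inj₂; [_,_])
open import Data.Empty using (⊥-elim)
open import Function using (_∘_; const)
open import Function.Bundles using (_⇔_; mk⇔; Equivalence)
open import Induction.WellFounded using (Acc; acc)
open import Relation.Nullary using (¬_; yes; no; contradiction)
open import Relation.Nullary.Decidable using (Dec; _×-dec_; ¬?; _→-dec_; decidable-stable)
open import Relation.Unary using (Pred; Decidable)
open import Relation.Binary.PropositionalEquality
  using (_≡_; _≢_; refl; sym; trans; cong; cong₂; subst; subst₂; module ≡-Reasoning)

private
  variable
    m n : ℕ
    p q r A B S : Subset n
    x y : Fin n

descent : ∀ {a ℓ g} {X : Set a} {P : Pred X ℓ} {G : Set g} (f : X → ℕ) →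
          (∀ {x} → P x → G ⊎ ∃ λ y → P y × f y < f x) → ∃ P → G
descent {P = P} {G = G} f step (x , px) = go px (<-wellFounded (f x))
  where
  go : ∀ {x} → P x → Acc _<_ (f x) → G
  go px (acc smaller) with step px
  ... | inj₁ g = g
  ... | inj₂ (y , py , fy<fx) = go py (smaller fy<fx)

module _ {a ℓ₁ ℓ₂} {X : Set a} {P : Pred X ℓ₁} {Q : Pred X ℓ₂}
         (P? : Decidable P) (Q? : Decidable Q) where

  length-filter-≤ : ∀ xs → ¬ Any (λ z → Q z × ¬ P z) xs →
                    length (filter Q? xs) ≤ length (filter P? xs)
  length-filter-≤ []       _     = z≤n
  length-filter-≤ (z ∷ xs) Q⇏P with Q? z | P? z
  ... | yes qz | no ¬pz = contradiction (Any.here (qz , ¬pz)) Q⇏P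
  ... | yes _  | yes _  = s≤s (length-filter-≤ xs (Q⇏P ∘ Any.there))
  ... | no _   | yes _  = m≤n⇒m≤1+n (length-filter-≤ xs (Q⇏P ∘ Any.there))
  ... | no _   | no _   = length-filter-≤ xs (Q⇏P ∘ Any.there)

  length-filter-< : ∀ xs → ¬ Any (λ z → Q z × ¬ P z) xs → Any (λ z → P z × ¬ Q z) xs →
                    length (filter Q? xs) < length (filter P? xs)
  length-filter-< (z ∷ xs) Q⇏P (Any.here (pz , ¬qz)) with Q? z | P? z
  ... | yes qz | _      = contradiction qz ¬qz
  ... | no _   | yes _  = s≤s (length-filter-≤ xs (Q⇏P ∘ Any.there))
  ... | no _   | no ¬pz = contradiction pz ¬pz
  length-filter-< (z ∷ xs) Q⇏P (Any.there P∖Q) with Q? z | P? z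
  ... | yes qz | no ¬pz = contradiction (Any.here (qz , ¬pz)) Q⇏P
  ... | yes _  | yes _  = s≤s (length-filter-< xs (Q⇏P ∘ Any.there) P∖Q)
  ... | no _   | yes _  = m<n⇒m<1+n (length-filter-< xs (Q⇏P ∘ Any.there) P∖Q)
  ... | no _   | no _   = length-filter-< xs (Q⇏P ∘ Any.there) P∖Q

p⊈q⇒∃∈p∉q : p ⊈ q → ∃ λ i → i ∈ p × i ∉ q
p⊈q⇒∃∈p∉q {n} {p} {q} p⊈q =
  let i , p⇏q = ¬∀⟶∃¬ n (λ i → i ∈ p → i ∈ q) (λ i → i ∈? p →-dec i ∈? q) (λ p⊆q → p⊈q (p⊆q _))
  in i , decidable-stable (i ∈? p) (λ i∉p → p⇏q (⊥-elim ∘ i∉p)) , p⇏q ∘ const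

∣p∪q∣≡∣p∣+∣q∣ : ∀ (p q : Subset n) → (∀ {i} → i ∈ p → i ∉ q) → ∣ p ∪ q ∣ ≡ ∣ p ∣ + ∣ q ∣
∣p∪q∣≡∣p∣+∣q∣ []            []            _        = refl
∣p∪q∣≡∣p∣+∣q∣ (inside  ∷ p) (inside  ∷ q) disjoint = contradiction here (disjoint here)
∣p∪q∣≡∣p∣+∣q∣ (inside  ∷ p) (outside ∷ q) disjoint =
  cong suc (∣p∪q∣≡∣p∣+∣q∣ p q λ i∈p → disjoint (there i∈p) ∘ there)
∣p∪q∣≡∣p∣+∣q∣ (outside ∷ p) (inside  ∷ q) disjoint = begin
  suc ∣ p ∪ q ∣       ≡⟨ cong suc (∣p∪q∣≡∣p∣+∣q∣ p q λ i∈p → disjoint (there i∈p) ∘ there) ⟩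
  suc (∣ p ∣ + ∣ q ∣) ≡⟨ +-suc ∣ p ∣ ∣ q ∣ ⟨
  ∣ p ∣ + suc ∣ q ∣   ∎
  where open ≡-Reasoning
∣p∪q∣≡∣p∣+∣q∣ (outside ∷ p) (outside ∷ q) disjoint =
  ∣p∪q∣≡∣p∣+∣q∣ p q λ i∈p → disjoint (there i∈p) ∘ there

∣⊥∣≤ : ∀ n m → ∣ ⊥ {n} ∣ ≤ m
∣⊥∣≤ n m = subst (_≤ m) (sym (∣⊥∣≡0 n)) z≤n

∃-between-of-size : p ⊆ r → ∣ p ∣ ≤ m → m ≤ ∣ r ∣ → ∃ λ q → p ⊆ q × q ⊆ r × ∣ q ∣ ≡ m
∃-between-of-size {p = []} {r = []} {zero} _ _ _ = [] , ⊆-refl , ⊆-refl , refl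
∃-between-of-size {p = inside ∷ p} {r = outside ∷ r} p⊆r _ _ = contradiction (p⊆r here) λ ()
∃-between-of-size {p = inside ∷ p} {r = inside ∷ r} {suc m} p⊆r (s≤s ∣p∣≤m) (s≤s m≤∣r∣) =
  let q , p⊆q , q⊆r , ∣q∣≡m = ∃-between-of-size (drop-∷-⊆ p⊆r) ∣p∣≤m m≤∣r∣
  in inside ∷ q , in⊆in p⊆q , in⊆in q⊆r , cong suc ∣q∣≡m
∃-between-of-size {p = outside ∷ p} {r = outside ∷ r} p⊆r ∣p∣≤m m≤∣r∣ =
  let q , p⊆q , q⊆r , ∣q∣≡m = ∃-between-of-size (drop-∷-⊆ p⊆r) ∣p∣≤m m≤∣r∣
  in outside ∷ q , out⊆ p⊆q , out⊆ q⊆r , ∣q∣≡m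
∃-between-of-size {p = outside ∷ p} {r = inside ∷ r} {m} p⊆r ∣p∣≤m _ with m ≤? ∣ r ∣
... | yes m≤∣r∣ =
  let q , p⊆q , q⊆r , ∣q∣≡m = ∃-between-of-size (drop-∷-⊆ p⊆r) ∣p∣≤m m≤∣r∣
  in outside ∷ q , out⊆ p⊆q , out⊆ q⊆r , ∣q∣≡m
∃-between-of-size {p = outside ∷ p} {r = inside ∷ r} {suc m} p⊆r ∣p∣≤1+m (s≤s m≤∣r∣) | no 1+m≰∣r∣ =
  let ∣p∣≤m = ≤-trans (p⊆q⇒∣p∣≤∣q∣ (drop-∷-⊆ p⊆r)) (≮⇒≥ 1+m≰∣r∣)
      q , p⊆q , q⊆r , ∣q∣≡m = ∃-between-of-size (drop-∷-⊆ p⊆r) ∣p∣≤m m≤∣r∣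
  in inside ∷ q , out⊆ p⊆q , in⊆in q⊆r , cong suc ∣q∣≡m
∃-between-of-size {p = outside ∷ p} {r = inside ∷ r} {zero} _ _ _ | no 0≰∣r∣ = contradiction z≤n 0≰∣r∣

∩-≡ : B ⊆ A → (∀ {i} → i ∈ A → (i ∈ S ⇔ i ∈ B)) → A ∩ S ≡ B
∩-≡ {A = A} {S = S} B⊆A agree = ⊆-antisym
  (λ i∈A∩S → let i∈A , i∈S = x∈p∩q⁻ A S i∈A∩S in Equivalence.to (agree i∈A) i∈S)
  (λ i∈B → x∈p∩q⁺ (B⊆A i∈B , Equivalence.from (agree (B⊆A i∈B)) i∈B))

∈⁅x⁆∪⁅y⁆⁻ : ∀ {i} (x y : Fin n) → i ∈ ⁅ x ⁆ ∪ ⁅ y ⁆ → i ≡ x ⊎ i ≡ y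
∈⁅x⁆∪⁅y⁆⁻ x y = Sum.map (x∈⁅y⁆⇒x≡y x) (x∈⁅y⁆⇒x≡y y) ∘ x∈p∪q⁻ ⁅ x ⁆ ⁅ y ⁆

∣⁅x⁆∪⁅y⁆∣≡2 : x ≢ y → ∣ ⁅ x ⁆ ∪ ⁅ y ⁆ ∣ ≡ 2
∣⁅x⁆∪⁅y⁆∣≡2 {x = x} {y} x≢y = begin
  ∣ ⁅ x ⁆ ∪ ⁅ y ⁆ ∣     ≡⟨ ∣p∪q∣≡∣p∣+∣q∣ ⁅ x ⁆ ⁅ y ⁆ disjoint ⟩
  ∣ ⁅ x ⁆ ∣ + ∣ ⁅ y ⁆ ∣ ≡⟨ cong₂ _+_ (∣⁅x⁆∣≡1 x) (∣⁅x⁆∣≡1 y) ⟩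
  2                     ∎
  where
  open ≡-Reasoning
  disjoint : ∀ {i} → i ∈ ⁅ x ⁆ → i ∉ ⁅ y ⁆
  disjoint i∈⁅x⁆ i∈⁅y⁆ = x≢y (trans (sym (x∈⁅y⁆⇒x≡y x i∈⁅x⁆)) (x∈⁅y⁆⇒x≡y y i∈⁅y⁆))

Separates : Family n → Fin n → Fin n → Set
Separates F x y = Any (λ S → x ∈ S × y ∉ S) F

separates? : ∀ (F : Family n) x y → Dec (Separates F x y)
separates? F x y = Any.any? (λ S → x ∈? S ×-dec ¬? (y ∈? S)) F

separates⇒≢ : ∀ {F : Family n} → Separates F x y → x ≢ y
separates⇒≢ x∖y refl = let _ , x∈S , x∉S = satisfied x∖y in x∉S x∈S

occurrences : Family n → Fin n → ℕ
occurrences F x = length (filter (x ∈?_) F)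

occurrences-< : ∀ {F : Family n} → Separates F x y → ¬ Separates F y x →
                occurrences F y < occurrences F x
occurrences-< {x = x} {y} {F} x∖y ¬y∖x = length-filter-< (x ∈?_) (y ∈?_) F ¬y∖x x∖y

pair-shattered : ∀ {F : Family n} →
                 Any (λ S → x ∈ S × y ∈ S) F → Separates F x y → Separates F y x →
                 Any (λ S → x ∉ S × y ∉ S) F → Shattered F (⁅ x ⁆ ∪ ⁅ y ⁆)
pair-shattered {x = x} {y} {F} both x∖y y∖x neither B B⊆xy = realise (x ∈? B) (y ∈? B)
  where
  in⇔in : ∀ {a b} {P : Set a} {Q : Set b} → P → Q → P ⇔ Q
  in⇔in p q = mk⇔ (const q) (const p)
  out⇔out : ∀ {a b} {P : Set a} {Q : Set b} → ¬ P → ¬ Q → P ⇔ Q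
  out⇔out ¬p ¬q = mk⇔ (⊥-elim ∘ ¬p) (⊥-elim ∘ ¬q)
  trace : ∀ {S} → (x ∈ S ⇔ x ∈ B) → (y ∈ S ⇔ y ∈ B) → (⁅ x ⁆ ∪ ⁅ y ⁆) ∩ S ≡ B
  trace x⇔ y⇔ = ∩-≡ B⊆xy λ i∈xy → [ (λ { refl → x⇔ }) , (λ { refl → y⇔ }) ] (∈⁅x⁆∪⁅y⁆⁻ x y i∈xy)
  realise : Dec (x ∈ B) → Dec (y ∈ B) → Any (λ S → (⁅ x ⁆ ∪ ⁅ y ⁆) ∩ S ≡ B) F
  realise (yes x∈B) (yes y∈B) = Any.map (λ (x∈S , y∈S) → trace (in⇔in x∈S x∈B) (in⇔in y∈S y∈B)) both
  realise (yes x∈B) (no y∉B)  = Any.map (λ (x∈S , y∉S) → trace (in⇔in x∈S x∈B) (out⇔out y∉S y∉B)) x∖y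
  realise (no x∉B)  (yes y∈B) = Any.map (λ (y∈S , x∉S) → trace (out⇔out x∉S x∉B) (in⇔in y∈S y∈B)) y∖x
  realise (no x∉B)  (no y∉B)  = Any.map (λ (x∉S , y∉S) → trace (out⇔out x∉S x∉B) (out⇔out y∉S y∉B)) neither

∣r∣<∣p∣+∣∁q∣⇒∁q⊈r : p ⊆ q → p ⊆ r → ∣ r ∣ < ∣ p ∣ + ∣ ∁ q ∣ → ∁ q ⊈ r
∣r∣<∣p∣+∣∁q∣⇒∁q⊈r {p = p} {q} {r} p⊆q p⊆r ∣r∣<∣p∣+∣∁q∣ ∁q⊆r = <⇒≱ ∣r∣<∣p∣+∣∁q∣ (begin
  ∣ p ∣ + ∣ ∁ q ∣ ≡⟨ ∣p∪q∣≡∣p∣+∣q∣ p (∁ q) (x∈p⇒x∉∁p ∘ p⊆q) ⟨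
  ∣ p ∪ ∁ q ∣     ≤⟨ p⊆q⇒∣p∣≤∣q∣ ([ p⊆r , ∁q⊆r ] ∘ x∈p∪q⁻ p (∁ q)) ⟩
  ∣ r ∣           ∎)
  where open ≤-Reasoning

covering-≤ : ∀ {k} {F : Family n} → Covering k F → k ≤ n → ∣ A ∣ ≤ k → Any (A ⊆_) F
covering-≤ {n} {k = k} covering k≤n ∣A∣≤k =
  let K , A⊆K , _ , ∣K∣≡k = ∃-between-of-size ⊆⊤ ∣A∣≤k (subst (k ≤_) (sym (∣⊤∣≡n n)) k≤n)
  in Any.map (⊆-trans A⊆K) (covering K ∣K∣≡k)

s<[k∸1]+[n∸s] : ∀ {k s n} → 1 ≤ k → s < 2 * k → s + k < n → s < k ∸ 1 + (n ∸ s)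
s<[k∸1]+[n∸s] {k} {s} {n} 1≤k s<2k s+k<n = begin-strict
  s               <⟨ s<2k ⟩
  2 * k           ≡⟨ cong (k +_) (+-identityʳ k) ⟩
  k + k           ≡⟨ cong (_+ k) (m+[n∸m]≡n 1≤k) ⟨
  suc (k ∸ 1) + k ≡⟨ +-suc (k ∸ 1) k ⟨
  k ∸ 1 + suc k   ≤⟨ +-monoʳ-≤ (k ∸ 1) k<n∸s ⟩
  k ∸ 1 + (n ∸ s) ∎
  where
  open ≤-Reasoning
  k<n∸s : k < n ∸ s
  k<n∸s = m+n≤o⇒m≤o∸n (suc k) (subst (_≤ n) (cong suc (+-comm s k)) s+k<n)

module OutsideMember {n k s : ℕ} {F : Family n} (uniform : Uniform s F) (covering : Covering k F)
                     (2≤k : 2 ≤ k) (k≤s : k ≤ s) (s<2k : s < 2 * k) (s+k<n : s + k < n)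
                     {S₀ : Subset n} (S₀∈F : S₀ ∈ₗ F) where

  1≤k : 1 ≤ k
  1≤k = <⇒≤ 2≤k

  k≤n : k ≤ n
  k≤n = m+n≤o⇒n≤o s (<⇒≤ s+k<n)

  ∣S₀∣≡s : ∣ S₀ ∣ ≡ s
  ∣S₀∣≡s = All.lookup uniform S₀∈F

  separated-outside : x ∉ S₀ → ∃ λ y → y ∉ S₀ × Separates F x y
  separated-outside {x} x∉S₀ =
    let T , _ , T⊆S₀ , ∣T∣≡k∸1 = ∃-between-of-size ⊥⊆ (∣⊥∣≤ n (k ∸ 1)) k∸1≤∣S₀∣
        S , S∈F , x∪T⊆S = find (covering (⁅ x ⁆ ∪ T) (∣⁅x⁆∪T∣≡k T⊆S₀ ∣T∣≡k∸1))
        y , y∈∁S₀ , y∉S = p⊈q⇒∃∈p∉q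
          (∣r∣<∣p∣+∣∁q∣⇒∁q⊈r T⊆S₀ (⊆-trans (q⊆p∪q ⁅ x ⁆ T) x∪T⊆S) (∣S∣<∣T∣+∣∁S₀∣ T S∈F ∣T∣≡k∸1))
    in y , x∈∁p⇒x∉p y∈∁S₀ , lose S∈F (x∪T⊆S (p⊆p∪q T (x∈⁅x⁆ x)) , y∉S)
    where
    k∸1≤∣S₀∣ : k ∸ 1 ≤ ∣ S₀ ∣
    k∸1≤∣S₀∣ = subst (k ∸ 1 ≤_) (sym ∣S₀∣≡s) (≤-trans (m∸n≤m k 1) k≤s)
    ∣⁅x⁆∪T∣≡k : ∀ {T} → T ⊆ S₀ → ∣ T ∣ ≡ k ∸ 1 → ∣ ⁅ x ⁆ ∪ T ∣ ≡ k
    ∣⁅x⁆∪T∣≡k {T} T⊆S₀ ∣T∣≡k∸1 = begin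
      ∣ ⁅ x ⁆ ∪ T ∣     ≡⟨ ∣p∪q∣≡∣p∣+∣q∣ ⁅ x ⁆ T x∉T ⟩
      ∣ ⁅ x ⁆ ∣ + ∣ T ∣ ≡⟨ cong₂ _+_ (∣⁅x⁆∣≡1 x) ∣T∣≡k∸1 ⟩
      suc (k ∸ 1)       ≡⟨ m+[n∸m]≡n 1≤k ⟩
      k                 ∎
      where
      open ≡-Reasoning
      x∉T : ∀ {i} → i ∈ ⁅ x ⁆ → i ∉ T
      x∉T i∈⁅x⁆ i∈T = x∉S₀ (subst (_∈ S₀) (x∈⁅y⁆⇒x≡y x i∈⁅x⁆) (T⊆S₀ i∈T))
    ∣S∣<∣T∣+∣∁S₀∣ : ∀ {S} T → S ∈ₗ F → ∣ T ∣ ≡ k ∸ 1 → ∣ S ∣ < ∣ T ∣ + ∣ ∁ S₀ ∣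
    ∣S∣<∣T∣+∣∁S₀∣ _ S∈F ∣T∣≡k∸1
      rewrite All.lookup uniform S∈F | ∣T∣≡k∸1 | ∣∁p∣≡n∸∣p∣ S₀ | ∣S₀∣≡s = s<[k∸1]+[n∸s] 1≤k s<2k s+k<n

  IncomparableOutside : Set
  IncomparableOutside = ∃₂ λ x y → x ∉ S₀ × y ∉ S₀ × Separates F x y × Separates F y x

  incomparable-or-fewer : x ∉ S₀ →
    IncomparableOutside ⊎ ∃ λ y → y ∉ S₀ × occurrences F y < occurrences F x
  incomparable-or-fewer {x} x∉S₀ with separated-outside x∉S₀
  ... | y , y∉S₀ , x∖y with separates? F y x
  ...   | yes y∖x = inj₁ (x , y , x∉S₀ , y∉S₀ , x∖y , y∖x)
  ...   | no ¬y∖x = inj₂ (y , y∉S₀ , occurrences-< x∖y ¬y∖x)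

  ∃∉S₀ : ∃ λ x → x ∉ S₀
  ∃∉S₀ = let x , _ , x∉S₀ = p⊈q⇒∃∈p∉q ⊤⊈S₀ in x , x∉S₀
    where
    ⊤⊈S₀ : ⊤ ⊈ S₀
    ⊤⊈S₀ ⊤⊆S₀ = <⇒≱ (m+n≤o⇒m≤o (suc s) s+k<n)
                     (subst₂ _≤_ (∣⊤∣≡n n) ∣S₀∣≡s (p⊆q⇒∣p∣≤∣q∣ ⊤⊆S₀))

  incomparable-outside : IncomparableOutside
  incomparable-outside = descent (occurrences F) incomparable-or-fewer ∃∉S₀

  shattered-pair : ∃ λ A → ∣ A ∣ ≡ 2 × Shattered F A
  shattered-pair with incomparable-outside
  ... | x , y , x∉S₀ , y∉S₀ , x∖y , y∖x =
    ⁅ x ⁆ ∪ ⁅ y ⁆ , ∣xy∣≡2 , pair-shattered both x∖y y∖x (lose S₀∈F (x∉S₀ , y∉S₀))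
    where
    ∣xy∣≡2 : ∣ ⁅ x ⁆ ∪ ⁅ y ⁆ ∣ ≡ 2
    ∣xy∣≡2 = ∣⁅x⁆∪⁅y⁆∣≡2 (separates⇒≢ x∖y)
    both : Any (λ S → x ∈ S × y ∈ S) F
    both = Any.map (λ xy⊆S → xy⊆S (p⊆p∪q ⁅ y ⁆ (x∈⁅x⁆ x)) , xy⊆S (q⊆p∪q ⁅ x ⁆ ⁅ y ⁆ (x∈⁅x⁆ y)))
                   (covering-≤ covering k≤n (subst (_≤ k) (sym ∣xy∣≡2) 2≤k))

uniform-covering⇒shatters-pair : ∀ {k s} {F : Family n} → Uniform s F → Covering k F →
  2 ≤ k → k ≤ s → s < 2 * k → s + k < n → ∃ λ A → ∣ A ∣ ≡ 2 × Shattered F A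
uniform-covering⇒shatters-pair {n} {k} {s} uniform covering 2≤k k≤s s<2k s+k<n =
  let _ , S₀∈F , _ = find (covering-≤ {A = ⊥} covering (m+n≤o⇒n≤o s (<⇒≤ s+k<n)) (∣⊥∣≤ n k))
  in OutsideMember.shattered-pair uniform covering 2≤k k≤s s<2k s+k<n S₀∈F

mainTheorem2 : (k s n : ℕ) → 2 ≤ k → k ≤ s → s < 2 * k → s + k < n →
                   (d : ℕ) → IsD k s n d → 1 < d
mainTheorem2 k s n 2≤k k≤s s<2k s+k<n d ((F , uniform , covering , _ , shattered⇒≤d) , _) =
  let A , ∣A∣≡2 , A-shattered = uniform-covering⇒shatters-pair uniform covering 2≤k k≤s s<2k s+k<n
  in subst (_≤ d) ∣A∣≡2 (shattered⇒≤d A A-shattered)
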